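{- Let $T$ be a finite tree and $\ell\ge 1$ an integer. Maker has a winning strategy in the $K_{1,\ell}$-game on $T$ if and only if there exists a subtree $T'$ of $T$ (a connected subgraph of $T$, possibly a single vertex) such that every vertex $x$ of $T'$ satisfies $d_T(x)\ge 2\ell-1-d_{T'}(x)$, where $d_T(x)$ and $d_{T'}(x)$ denote the degrees of $x$ in $T$ and in $T'$, respectively.
   Context: In a Maker-Breaker game on the edge set of a graph $G$, Maker and Breaker alternately claim previously unclaimed edges of $G$, Maker first, until all edges are claimed; Maker wins if she claims all edges of some winning set, and Breaker wins otherwise. In the $K_{1,\ell}$-game, the winning sets are the edge sets of subgraphs isomorphic to the star $K_{1,\ell}$; i.e. Maker wins if she claims $\ell$ edges incident to a common vertex. -}

module Defs where

open import Data.Nat using (ℕ; zero; suc; _+_; _*_; _∸_; _≤_)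
open import Data.Fin using (Fin; zero; suc)
open import Data.Fin.Properties using (_≟_)
open import Data.Bool using (Bool; true; false; if_then_else_; _∧_; _∨_)
open import Data.Product using (_×_; _,_; proj₁; proj₂; ∃; ∃-syntax; Σ)
open import Data.Sum using (_⊎_)
open import Data.List using (List; []; _∷_; _++_; [_]; length)
open import Data.List.Relation.Unary.Linked using (Linked)
open import Data.List.Relation.Unary.Unique.Propositional using (Unique)
open import Relation.Nullary using (¬_)
open import Relation.Nullary.Decidable using (⌊_⌋)
open import Relation.Binary.PropositionalEquality using (_≡_; _≢_)
open import Function.Bundles using (_⇔_)

count : {m : ℕ} → (Fin m → Bool) → ℕ
count {zero}  f = 0
count {suc m} f = (if f zero then 1 else 0) + count (λ i → f (suc i))

incident : {n : ℕ} → Fin n × Fin n → Fin n → Bool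
incident (u , v) x = ⌊ x ≟ u ⌋ ∨ ⌊ x ≟ v ⌋

module _ {n m : ℕ} (ends : Fin m → Fin n × Fin n) where

  degIn : (Fin m → Bool) → Fin n → ℕ
  degIn F x = count (λ i → F i ∧ incident (ends i) x)

  deg : Fin n → ℕ
  deg = degIn (λ _ → true)

  Joins : Fin m → Fin n → Fin n → Set
  Joins i u v = (ends i ≡ (u , v)) ⊎ (ends i ≡ (v , u))

  Adj : Fin n → Fin n → Set
  Adj u v = ∃[ i ] Joins i u v

  Simple : Set
  Simple = (∀ i → proj₁ (ends i) ≢ proj₂ (ends i))
         × (∀ i j → Joins j (proj₁ (ends i)) (proj₂ (ends i)) → i ≡ j)

  data Walk (F : Fin m → Bool) : Fin n → Fin n → Set where
    here : ∀ {u} → Walk F u u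
    step : ∀ {u w v} (i : Fin m) → F i ≡ true → Joins i u w → Walk F w v → Walk F u v

  Connected : Set
  Connected = ∀ u v → Walk (λ _ → true) u v

  HasCycle : Set
  HasCycle = ∃[ v ] ∃[ vs ] (2 ≤ length vs × Unique (v ∷ vs) × Linked Adj (v ∷ vs ++ [ v ]))

  IsTree : Set
  IsTree = (1 ≤ n) × Simple × Connected × ¬ HasCycle

  IsSubtree : (Fin n → Bool) → (Fin m → Bool) → Set
  IsSubtree S F = (∃[ x ] S x ≡ true)
                × (∀ i → F i ≡ true → S (proj₁ (ends i)) ≡ true × S (proj₂ (ends i)) ≡ true)
                × (∀ u v → S u ≡ true → S v ≡ true → Walk F u v)

  data Owner : Set where
    free maker breaker : Owner

  isMaker : Owner → Bool
  isMaker maker = true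
  isMaker _     = false

  State : Set
  State = Fin m → Owner

  claim : State → Fin m → Owner → State
  claim s i o j = if ⌊ j ≟ i ⌋ then o else s j

  MakerHasStar : ℕ → State → Set
  MakerHasStar ℓ s = ∃[ v ] ℓ ≤ count (λ i → isMaker (s i) ∧ incident (ends i) v)

  data Turn : Set where
    makerTurn breakerTurn : Turn

  data MakerWins (ℓ : ℕ) : State → Turn → Set where
    won     : ∀ {s t} → MakerHasStar ℓ s → MakerWins ℓ s t
    mmove   : ∀ {s} (i : Fin m) → s i ≡ free →
              MakerWins ℓ (claim s i maker) breakerTurn → MakerWins ℓ s makerTurn
    bmove   : ∀ {s} → (∃[ i ] s i ≡ free) →
              (∀ i → s i ≡ free → MakerWins ℓ (claim s i breaker) makerTurn) →
              MakerWins ℓ s breakerTurn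

  MakerWinsGame : ℕ → Set
  MakerWinsGame ℓ = MakerWins ℓ (λ _ → free) makerTurn

-- Maker: give each edge at a vertex x a value (Breaker's 0, free 1, free and in a
-- chosen edge set F 2, Maker's 2). The potential of x, the sum over its edges, is
-- d_T(x) + d_F(x) on the empty board and twice Maker's degree on a full one, so a good
-- subtree (S, F) makes the potential at least 2ℓ − 1 on S. Maker keeps this property:
-- she claims a free edge e of F; Breaker's reply lies on one side of e in T − e, and
-- the other side (with e now Maker's) keeps its potential. Without free F-edges she
-- plays greedily at a single vertex of S, gaining one there per round while Breaker
-- takes at most one.
--
-- Breaker: if there is no good subtree, repeatedly deleting from the remaining vertex
-- set W a vertex v with d_T(v) + d_W(v) ≤ 2ℓ − 2 empties the tree, for otherwise the
-- component of W containing a remaining vertex is a good subtree. Orient every edge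
-- towards its endpoint deleted later. Breaker answers each Maker edge oriented into y
-- with an edge at y; then Maker owns at most out(y) + b(y) + 1 edges at y, where b(y)
-- counts Breaker's, and d_T(y) + out(y) ≤ 2ℓ − 2 keeps her degree below ℓ.

module Submission where

open import Defs
open import Data.Bool using (Bool; true; false; if_then_else_; _∧_; _∨_; not)
open import Data.Bool.Properties
  using (∧-conicalˡ; ∧-conicalʳ; ∧-identityʳ; ∧-zeroʳ; not-¬; ¬-not; not-injective)
  renaming (_≟_ to _≟ᵇ_)
open import Data.Empty using (⊥; ⊥-elim)
open import Data.Fin using (Fin; zero; suc; punchIn)
open import Data.Fin.Properties using (_≟_; any?; punchInᵢ≢i)
open import Data.List using (List; []; _∷_; _++_; [_])
open import Data.List.Relation.Unary.All using (All; [])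
open import Data.List.Relation.Unary.All.Properties using (¬Any⇒All¬)
open import Data.List.Relation.Unary.AllPairs using ([]; _∷_)
open import Data.List.Relation.Unary.Any using (Any; here; there) renaming (any? to anyᴸ?)
open import Data.List.Relation.Unary.Linked using (Linked; [-]; _∷_)
open import Data.List.Relation.Unary.Unique.Propositional using (Unique)
open import Data.Nat using (ℕ; zero; suc; _+_; _*_; _∸_; _≤_; _<_; z≤n; s≤s; _≤?_; _<?_)
open import Data.Nat.Properties
  using (+-*-semiring; +-mono-≤; +-monoˡ-≤; +-monoʳ-≤; +-comm; +-identityʳ; +-suc; +-cancelʳ-≡;
         ≤-refl; ≤-reflexive; ≤-trans; ≤-antisym; ≤-pred; ≤-<-trans; <⇒≤; <⇒≱; ≰⇒>; ≮⇒≥;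
         m≤n⇒m≤1+n; m≤m+n; m≤n+m∸n; m≤n+o⇒m∸n≤o; n≤0⇒n≡0; suc-injective;
         *-suc; *-monoʳ-≤; ∸-monoˡ-≤; ∸-monoʳ-<; module ≤-Reasoning)
open import Data.Nat.Solver using (module +-*-Solver)
open import Data.Product using (_×_; _,_; proj₁; proj₂; ∃-syntax; Σ-syntax)
open import Data.Product.Properties using (≡-dec)
open import Data.Sum using (_⊎_; inj₁; inj₂; map₂)
open import Function using (_∘_; case_of_)
open import Function.Bundles using (_⇔_; mk⇔)
open import Relation.Binary.PropositionalEquality hiding ([_])
open import Relation.Nullary using (¬_; Dec; yes; no)
open import Relation.Nullary.Decidable using (⌊_⌋; _×-dec_; _⊎-dec_)

open import Algebra.Properties.Semiring.Sum +-*-semiring using (sum; sum-remove; ∑-distrib-+; *-distribˡ-sum)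

𝟙 : Bool → ℕ
𝟙 b = if b then 1 else 0

sum-mono-≤ : ∀ {m} {f g : Fin m → ℕ} → (∀ i → f i ≤ g i) → sum f ≤ sum g
sum-mono-≤ {zero}  _   = z≤n
sum-mono-≤ {suc m} f≤g = +-mono-≤ (f≤g zero) (sum-mono-≤ (f≤g ∘ suc))

sum-update-≤ : ∀ {m} {f g : Fin m → ℕ} (i : Fin m) → (∀ k → k ≢ i → f k ≤ g k) →
               sum f + g i ≤ sum g + f i
sum-update-≤ {suc m} {f} {g} i f≤g = begin
  sum f + g i                       ≡⟨ cong (_+ g i) (sum-remove f) ⟩
  f i + sum (f ∘ punchIn i) + g i   ≤⟨ +-monoˡ-≤ (g i) (+-monoʳ-≤ (f i) rest≤) ⟩
  f i + sum (g ∘ punchIn i) + g i   ≡⟨ swap (f i) _ (g i) ⟩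
  g i + sum (g ∘ punchIn i) + f i   ≡⟨ cong (_+ f i) (sum-remove g) ⟨
  sum g + f i                       ∎
  where
  open ≤-Reasoning
  open +-*-Solver
  rest≤ : sum (f ∘ punchIn i) ≤ sum (g ∘ punchIn i)
  rest≤ = sum-mono-≤ (λ k → f≤g (punchIn i k) (punchInᵢ≢i i k))
  swap : ∀ a x b → a + x + b ≡ b + x + a
  swap = solve 3 (λ a x b → a :+ x :+ b := b :+ x :+ a) refl

sum-update : ∀ {m} {f g : Fin m → ℕ} (i : Fin m) → (∀ k → k ≢ i → f k ≡ g k) →
             sum f + g i ≡ sum g + f i
sum-update i agree = ≤-antisym (sum-update-≤ i (λ k k≢i → ≤-reflexive (agree k k≢i)))
                               (sum-update-≤ i (λ k k≢i → ≤-reflexive (sym (agree k k≢i))))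

count≡sum : ∀ {m} (f : Fin m → Bool) → count f ≡ sum (𝟙 ∘ f)
count≡sum {zero}  f = refl
count≡sum {suc m} f = cong (𝟙 (f zero) +_) (count≡sum (f ∘ suc))

𝟙-mono : ∀ {a b} → (a ≡ true → b ≡ true) → 𝟙 a ≤ 𝟙 b
𝟙-mono {false} _    = z≤n
𝟙-mono {true}  a⇒b rewrite a⇒b refl = ≤-refl

𝟙≤1 : ∀ b → 𝟙 b ≤ 1
𝟙≤1 false = z≤n
𝟙≤1 true  = ≤-refl

module _ {m : ℕ} where

  count-mono-≤ : {f g : Fin m → Bool} → (∀ i → f i ≡ true → g i ≡ true) → count f ≤ count g
  count-mono-≤ {f} {g} f⊆g = begin
    count f       ≡⟨ count≡sum f ⟩
    sum (𝟙 ∘ f)   ≤⟨ sum-mono-≤ (λ i → 𝟙-mono (f⊆g i)) ⟩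
    sum (𝟙 ∘ g)   ≡⟨ count≡sum g ⟨
    count g       ∎
    where open ≤-Reasoning

  count-update : {f g : Fin m → Bool} (i : Fin m) → (∀ k → k ≢ i → f k ≡ g k) →
                 count f + 𝟙 (g i) ≡ count g + 𝟙 (f i)
  count-update {f} {g} i agree = begin
    count f + 𝟙 (g i)       ≡⟨ cong (_+ 𝟙 (g i)) (count≡sum f) ⟩
    sum (𝟙 ∘ f) + 𝟙 (g i)   ≡⟨ sum-update i (λ k k≢i → cong 𝟙 (agree k k≢i)) ⟩
    sum (𝟙 ∘ g) + 𝟙 (f i)   ≡⟨ cong (_+ 𝟙 (f i)) (count≡sum g) ⟨
    count g + 𝟙 (f i)       ∎
    where open ≡-Reasoning

  count-strict-mono : {f g : Fin m → Bool} (v : Fin m) → (∀ i → f i ≡ true → g i ≡ true) →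
                      f v ≡ false → g v ≡ true → suc (count f) ≤ count g
  count-strict-mono {f} {g} v f⊆g fv gv = begin
    suc (count f)          ≡⟨ +-comm 1 (count f) ⟩
    count f + 1            ≡⟨ cong₂ (λ c b → c + 𝟙 b) (count≡sum f) (sym gv) ⟩
    sum (𝟙 ∘ f) + 𝟙 (g v)  ≤⟨ sum-update-≤ v (λ k _ → 𝟙-mono (f⊆g k)) ⟩
    sum (𝟙 ∘ g) + 𝟙 (f v)  ≡⟨ cong₂ (λ c b → c + 𝟙 b) (count≡sum g) (sym fv) ⟨
    count g + 0            ≡⟨ +-identityʳ (count g) ⟩
    count g                ∎
    where open ≤-Reasoning

  count-+-≤ : {f g h : Fin m → Bool} → (∀ i → 𝟙 (f i) + 𝟙 (g i) ≤ 𝟙 (h i)) → count f + count g ≤ count h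
  count-+-≤ {f} {g} {h} pointwise = begin
    count f + count g          ≡⟨ cong₂ _+_ (count≡sum f) (count≡sum g) ⟩
    sum (𝟙 ∘ f) + sum (𝟙 ∘ g)  ≡⟨ ∑-distrib-+ (𝟙 ∘ f) (𝟙 ∘ g) ⟨
    sum (λ i → 𝟙 (f i) + 𝟙 (g i)) ≤⟨ sum-mono-≤ pointwise ⟩
    sum (𝟙 ∘ h)                ≡⟨ count≡sum h ⟨
    count h                    ∎
    where open ≤-Reasoning

  count-≤-+ : {f g h : Fin m → Bool} → (∀ i → 𝟙 (h i) ≤ 𝟙 (f i) + 𝟙 (g i)) → count h ≤ count f + count g
  count-≤-+ {f} {g} {h} pointwise = begin
    count h                    ≡⟨ count≡sum h ⟩
    sum (𝟙 ∘ h)                ≤⟨ sum-mono-≤ pointwise ⟩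
    sum (λ i → 𝟙 (f i) + 𝟙 (g i)) ≡⟨ ∑-distrib-+ (𝟙 ∘ f) (𝟙 ∘ g) ⟩
    sum (𝟙 ∘ f) + sum (𝟙 ∘ g)  ≡⟨ cong₂ _+_ (count≡sum f) (count≡sum g) ⟨
    count f + count g          ∎
    where open ≤-Reasoning

count≤size : ∀ {m} (f : Fin m → Bool) → count f ≤ m
count≤size {zero}  f = z≤n
count≤size {suc m} f with f zero
... | true  = s≤s (count≤size (f ∘ suc))
... | false = m≤n⇒m≤1+n (count≤size (f ∘ suc))

count-positive : ∀ {m} {f : Fin m → Bool} (i : Fin m) → f i ≡ true → 1 ≤ count f
count-positive {f = f} zero    fi rewrite fi = s≤s z≤n
count-positive {f = f} (suc i) fi with f zero
... | true  = s≤s z≤n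
... | false = count-positive {f = f ∘ suc} i fi

count-positive⇒∃ : ∀ {m} (f : Fin m → Bool) → 1 ≤ count f → ∃[ i ] f i ≡ true
count-positive⇒∃ {suc m} f 1≤c with f zero in f0
... | true  = zero , f0
... | false = let i , fi = count-positive⇒∃ (f ∘ suc) 1≤c in suc i , fi

count-none : ∀ {m} (f : Fin m → Bool) → (∀ i → f i ≡ false) → count f ≡ 0
count-none {zero}  f none = refl
count-none {suc m} f none rewrite none zero = count-none (f ∘ suc) (none ∘ suc)

true-iff⇒≡ : ∀ {a b} → (a ≡ true → b ≡ true) → (b ≡ true → a ≡ true) → a ≡ b
true-iff⇒≡ {false} {false} _ _ = refl
true-iff⇒≡ {false} {true}  _ b⇒a = b⇒a refl
true-iff⇒≡ {true}          a⇒b _ = sym (a⇒b refl)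

∨-elim : ∀ {a b} → a ∨ b ≡ true → a ≡ true ⊎ b ≡ true
∨-elim {true}  _ = inj₁ refl
∨-elim {false} b = inj₂ b

∨-introˡ : ∀ {a} b → a ≡ true → a ∨ b ≡ true
∨-introˡ b refl = refl

∨-introʳ : ∀ a {b} → b ≡ true → a ∨ b ≡ true
∨-introʳ true  _ = refl
∨-introʳ false b = b

module _ {P : Set} where

  ⌊⌋-true : (P? : Dec P) → P → ⌊ P? ⌋ ≡ true
  ⌊⌋-true (yes _) _ = refl
  ⌊⌋-true (no ¬p) p = ⊥-elim (¬p p)

  ⌊⌋-false : (P? : Dec P) → ¬ P → ⌊ P? ⌋ ≡ false
  ⌊⌋-false (yes p) ¬p = ⊥-elim (¬p p)
  ⌊⌋-false (no _)  _  = refl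

  ⌊⌋-true⁻ : (P? : Dec P) → ⌊ P? ⌋ ≡ true → P
  ⌊⌋-true⁻ (yes p) _ = p

  ⌊⌋-false⁻ : (P? : Dec P) → ⌊ P? ⌋ ≡ false → ¬ P
  ⌊⌋-false⁻ (no ¬p) _ = ¬p

k<ℓ⇒2k<2ℓ∸1 : ∀ {k ℓ} → k < ℓ → 2 * k < 2 * ℓ ∸ 1
k<ℓ⇒2k<2ℓ∸1 {k} k<ℓ = ∸-monoˡ-≤ 1 (≤-trans (≤-reflexive (sym (*-suc 2 k))) (*-monoʳ-≤ 2 k<ℓ))

2ℓ∸1≤2k⇒ℓ≤k : ∀ {ℓ k} → 2 * ℓ ∸ 1 ≤ 2 * k → ℓ ≤ k
2ℓ∸1≤2k⇒ℓ≤k {ℓ} {k} 2ℓ∸1≤2k with ℓ ≤? k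
... | yes ℓ≤k = ℓ≤k
... | no  ℓ≰k = ⊥-elim (<⇒≱ (k<ℓ⇒2k<2ℓ∸1 (≰⇒> ℓ≰k)) 2ℓ∸1≤2k)

2k≤2ℓ∸1⇒k<ℓ : ∀ {k ℓ} → 1 ≤ ℓ → 2 * k ≤ 2 * ℓ ∸ 1 → k < ℓ
2k≤2ℓ∸1⇒k<ℓ {k} {ℓ} 1≤ℓ 2k≤2ℓ∸1 with k <? ℓ
... | yes k<ℓ = k<ℓ
... | no  k≮ℓ = ⊥-elim (<⇒≱ (≤-<-trans 2k≤2ℓ∸1 2ℓ∸1<2ℓ) (*-monoʳ-≤ 2 (≮⇒≥ k≮ℓ)))
  where
  2ℓ∸1<2ℓ : 2 * ℓ ∸ 1 < 2 * ℓ
  2ℓ∸1<2ℓ = ∸-monoʳ-< (s≤s z≤n) (≤-trans 1≤ℓ (m≤m+n ℓ (ℓ + 0)))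

module Saturation {n : ℕ} (step : (Fin n → Bool) → Fin n → Bool)
  (step-inflationary : ∀ R v → R v ≡ true → step R v ≡ true)
  (step-mono : ∀ R R′ → (∀ v → R v ≡ true → R′ v ≡ true) → ∀ v → step R v ≡ true → step R′ v ≡ true)
  (R₀ : Fin n → Bool) where

  iterate : ℕ → Fin n → Bool
  iterate zero    = R₀
  iterate (suc k) = step (iterate k)

  Stable : (Fin n → Bool) → Set
  Stable R = ∀ v → step R v ≡ true → R v ≡ true

  stable-step : ∀ k → Stable (iterate k) → Stable (iterate (suc k))
  stable-step k st = step-mono (iterate (suc k)) (iterate k) st

  -- Every unstable round adds a vertex, so after n + 1 rounds the set is stable.
  stable-or-large : ∀ k → Stable (iterate k) ⊎ k ≤ count (iterate k)
  stable-or-large zero = inj₂ z≤n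
  stable-or-large (suc k) with stable-or-large k
  ... | inj₁ st = inj₁ (stable-step k st)
  ... | inj₂ large with any? (λ v → (step (iterate k) v ≟ᵇ true) ×-dec (iterate k v ≟ᵇ false))
  ...   | yes (v , new , old) =
            inj₂ (≤-trans (s≤s large) (count-strict-mono v (step-inflationary (iterate k)) old new))
  ...   | no none = inj₁ (stable-step k old)
    where
    old : Stable (iterate k)
    old v sv with iterate k v in e
    ... | true  = refl
    ... | false = ⊥-elim (none (v , sv , e))

  saturated : Fin n → Bool
  saturated = iterate (suc n)

  saturated-stable : Stable saturated
  saturated-stable with stable-or-large (suc n)
  ... | inj₁ st    = st
  ... | inj₂ large = ⊥-elim (<⇒≱ large (count≤size saturated))

module Graph {n m : ℕ} (ends : Fin m → Fin n × Fin n) where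

  end₁ end₂ : Fin m → Fin n
  end₁ i = proj₁ (ends i)
  end₂ i = proj₂ (ends i)

  incident-end₁ : ∀ i → incident (ends i) (end₁ i) ≡ true
  incident-end₁ i = ∨-introˡ _ (⌊⌋-true (end₁ i ≟ end₁ i) refl)

  incident-end₂ : ∀ i → incident (ends i) (end₂ i) ≡ true
  incident-end₂ i = ∨-introʳ _ (⌊⌋-true (end₂ i ≟ end₂ i) refl)

  incident⇒end : ∀ {i z} → incident (ends i) z ≡ true → z ≡ end₁ i ⊎ z ≡ end₂ i
  incident⇒end {i} {z} inc with ∨-elim inc
  ... | inj₁ z≡ = inj₁ (⌊⌋-true⁻ (z ≟ end₁ i) z≡)
  ... | inj₂ z≡ = inj₂ (⌊⌋-true⁻ (z ≟ end₂ i) z≡)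

  joins? : ∀ i u v → Dec (Joins ends i u v)
  joins? i u v = (pair≟ (ends i) (u , v)) ⊎-dec (pair≟ (ends i) (v , u))
    where pair≟ = ≡-dec _≟_ _≟_

  Joins-sym : ∀ {i u v} → Joins ends i u v → Joins ends i v u
  Joins-sym (inj₁ e) = inj₂ e
  Joins-sym (inj₂ e) = inj₁ e

  Joins⇒ends : ∀ {i u v} → Joins ends i u v → (u ≡ end₁ i × v ≡ end₂ i) ⊎ (u ≡ end₂ i × v ≡ end₁ i)
  Joins⇒ends {i} (inj₁ e) rewrite e = inj₁ (refl , refl)
  Joins⇒ends {i} (inj₂ e) rewrite e = inj₂ (refl , refl)

  _++ʷ_ : ∀ {F u w v} → Walk ends F u w → Walk ends F w v → Walk ends F u v
  here             ++ʷ q = q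
  step i Fi uw p   ++ʷ q = step i Fi uw (p ++ʷ q)

  reverseʷ : ∀ {F u v} → Walk ends F u v → Walk ends F v u
  reverseʷ here            = here
  reverseʷ (step i Fi uw p) = reverseʷ p ++ʷ step i Fi (Joins-sym uw) here

  walk-preserves : ∀ {A u v} (P : Fin n → Bool) →
                   (∀ {i a b} → A i ≡ true → Joins ends i a b → P a ≡ true → P b ≡ true) →
                   P u ≡ true → Walk ends A u v → P v ≡ true
  walk-preserves P closed Pu here             = Pu
  walk-preserves P closed Pu (step i Ai uw p) = walk-preserves P closed (closed Ai uw Pu) p

  walk-restrict : ∀ {A B u v} (P : Fin n → Bool) →
                  (∀ {i a b} → A i ≡ true → Joins ends i a b → P a ≡ true → B i ≡ true × P b ≡ true) →
                  P u ≡ true → Walk ends A u v → Walk ends B u v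
  walk-restrict P closed Pu here             = here
  walk-restrict P closed Pu (step i Ai uw p) =
    step i (proj₁ (closed Ai uw Pu)) uw (walk-restrict P closed (proj₂ (closed Ai uw Pu)) p)

  module Reach (A : Fin m → Bool) (x : Fin n) where

    Enters : (Fin n → Bool) → Fin n → Fin m → Set
    Enters R v i = A i ≡ true × ∃[ u ] (R u ≡ true × Joins ends i u v)

    enters? : ∀ R v i → Dec (Enters R v i)
    enters? R v i = (A i ≟ᵇ true) ×-dec any? (λ u → (R u ≟ᵇ true) ×-dec joins? i u v)

    grow : (Fin n → Bool) → Fin n → Bool
    grow R v = R v ∨ ⌊ any? (enters? R v) ⌋

    grow-mono : ∀ R R′ → (∀ v → R v ≡ true → R′ v ≡ true) → ∀ v → grow R v ≡ true → grow R′ v ≡ true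
    grow-mono R R′ R⊆R′ v gv with ∨-elim gv
    ... | inj₁ Rv     = ∨-introˡ _ (R⊆R′ v Rv)
    ... | inj₂ enters with ⌊⌋-true⁻ (any? (enters? R v)) enters
    ...   | i , Ai , u , Ru , uv = ∨-introʳ (R′ v) (⌊⌋-true (any? (enters? R′ v)) (i , Ai , u , R⊆R′ u Ru , uv))

    open Saturation grow (λ R v → ∨-introˡ _) grow-mono (λ v → ⌊ v ≟ x ⌋)

    reach : Fin n → Bool
    reach = saturated

    reach-source : reach x ≡ true
    reach-source = iterate-source (suc n)
      where
      iterate-source : ∀ k → iterate k x ≡ true
      iterate-source zero    = ⌊⌋-true (x ≟ x) refl
      iterate-source (suc k) = ∨-introˡ _ (iterate-source k)

    reach-closed : ∀ {i u v} → A i ≡ true → Joins ends i u v → reach u ≡ true → reach v ≡ true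
    reach-closed {i} {u} {v} Ai uv Ru =
      saturated-stable v (∨-introʳ (reach v) (⌊⌋-true (any? (enters? reach v)) (i , Ai , u , Ru , uv)))

    reach-edge : ∀ {i a b} → A i ≡ true → Joins ends i a b → reach a ≡ true →
                 reach (end₁ i) ≡ true × reach (end₂ i) ≡ true
    reach-edge Ai ab ra with Joins⇒ends ab
    ... | inj₁ (refl , refl) = ra , reach-closed Ai ab ra
    ... | inj₂ (refl , refl) = reach-closed Ai ab ra , ra

    reach-walk : ∀ v → reach v ≡ true → Walk ends A x v
    reach-walk = iterate-walk (suc n)
      where
      iterate-walk : ∀ k v → iterate k v ≡ true → Walk ends A x v
      iterate-walk zero    v v≡x rewrite ⌊⌋-true⁻ (v ≟ x) v≡x = here
      iterate-walk (suc k) v gv with ∨-elim gv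
      ... | inj₁ old    = iterate-walk k v old
      ... | inj₂ enters with ⌊⌋-true⁻ (any? (enters? (iterate k) v)) enters
      ...   | i , Ai , u , Ru , uv = iterate-walk k u Ru ++ʷ step i Ai uv here

  module Paths (A : Fin m → Bool) where

    data Path : Fin n → Fin n → Set
    successors : ∀ {u v} → Path u v → List (Fin n)

    vertices : ∀ {u v} → Path u v → List (Fin n)
    vertices {u} p = u ∷ successors p

    data Path where
      []  : ∀ {u} → Path u u
      extend : ∀ {u w v} (i : Fin m) → A i ≡ true → Joins ends i u w → (p : Path w v) →
               All (u ≢_) (vertices p) → Path u v

    successors []                   = []
    successors (extend _ _ _ p _) = vertices p

    shortcut : ∀ {u w v} (p : Path w v) → Any (u ≡_) (vertices p) → Path u v
    shortcut []                     (here refl) = []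
    shortcut (extend i Ai uw p u∉)  (here refl) = extend i Ai uw p u∉
    shortcut (extend i Ai uw p u∉)  (there u∈) = shortcut p u∈

    walk⇒path : ∀ {u v} → Walk ends A u v → Path u v
    walk⇒path here = []
    walk⇒path {u} (step i Ai uw walk) with walk⇒path walk
    ... | p with anyᴸ? (u ≟_) (vertices p)
    ...   | yes u∈ = shortcut p u∈
    ...   | no  u∉ = extend i Ai uw p (¬Any⇒All¬ _ u∉)

    vertices-unique : ∀ {u v} (p : Path u v) → Unique (vertices p)
    vertices-unique []                   = [] ∷ []
    vertices-unique (extend _ _ _ p u∉) = u∉ ∷ vertices-unique p

    vertices-linked : ∀ {u v z} (p : Path u v) → Adj ends v z → Linked (Adj ends) (vertices p ++ [ z ])
    vertices-linked []                     vz = vz ∷ [-]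
    vertices-linked (extend i _ uw p _) vz = (i , uw) ∷ vertices-linked p vz

  module Separation (simple : Simple ends) (acyclic : ¬ HasCycle ends) (i : Fin m) where

    avoiding : Fin m → Bool
    avoiding j = not ⌊ j ≟ i ⌋

    no-bypass : ¬ Walk ends avoiding (end₁ i) (end₂ i)
    no-bypass walk = no-path (walk⇒path walk) refl refl
      where
      open Paths avoiding
      no-path : ∀ {u v} → Path u v → u ≡ end₁ i → v ≡ end₂ i → ⊥
      no-path [] u≡ v≡ = proj₁ simple i (trans (sym u≡) v≡)
      no-path (extend j avoids uv [] _) refl refl with proj₂ simple i j uv
      ... | refl = ⌊⌋-false⁻ (j ≟ j) (not-injective avoids) refl
      no-path (extend j _ uv p@(extend _ _ _ _ _) u∉) refl refl =
        acyclic (end₁ i , vertices p , s≤s (s≤s z≤n) , u∉ ∷ vertices-unique p ,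
                 (j , uv) ∷ vertices-linked p (i , inj₂ refl))

    open Reach avoiding (end₁ i)

    side : Fin n → Bool
    side = reach

    side-end₁ : side (end₁ i) ≡ true
    side-end₁ = reach-source

    side-end₂ : side (end₂ i) ≡ false
    side-end₂ with side (end₂ i) in e
    ... | true  = ⊥-elim (no-bypass (reach-walk (end₂ i) e))
    ... | false = refl

    side-edge : ∀ j → j ≢ i → side (end₁ j) ≡ side (end₂ j)
    side-edge j j≢i = true-iff⇒≡ (reach-closed avoids (inj₁ refl)) (reach-closed avoids (inj₂ refl))
      where
      avoids : avoiding j ≡ true
      avoids = cong not (⌊⌋-false (j ≟ i) j≢i)

module Game {n m : ℕ} (ends : Fin m → Fin n × Fin n) where

  free? : (o : Owner ends) → Dec (o ≡ free)
  free? free    = yes refl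
  free? maker   = no λ ()
  free? breaker = no λ ()

  isFree : Owner ends → Bool
  isFree o = ⌊ free? o ⌋

  frees : State ends → ℕ
  frees s = count (isFree ∘ s)

  isBreaker : Owner ends → Bool
  isBreaker breaker = true
  isBreaker _       = false

  makerDeg breakerDeg freeDeg : State ends → Fin n → ℕ
  makerDeg   s x = count (λ i → isMaker ends (s i) ∧ incident (ends i) x)
  breakerDeg s x = count (λ i → isBreaker (s i) ∧ incident (ends i) x)
  freeDeg    s x = count (λ i → isFree (s i) ∧ incident (ends i) x)

  claim-at : ∀ s i o → claim ends s i o i ≡ o
  claim-at s i o rewrite ⌊⌋-true (i ≟ i) refl = refl

  claim-other : ∀ s i o {j} → j ≢ i → claim ends s i o j ≡ s j
  claim-other s i o {j} j≢i rewrite ⌊⌋-false (j ≟ i) j≢i = refl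

  sum-claim : ∀ s i o (c : Owner ends → Fin m → ℕ) →
              sum (λ k → c (claim ends s i o k) k) + c (s i) i ≡ sum (λ k → c (s k) k) + c o i
  sum-claim s i o c =
    subst (λ o′ → sum (λ k → c (claim ends s i o k) k) + c (s i) i ≡ sum (λ k → c (s k) k) + c o′ i)
          (claim-at s i o)
          (sum-update i (λ k k≢i → cong (λ o′ → c o′ k) (claim-other s i o k≢i)))

  module ClaimCount {s : State ends} {i : Fin m} (o : Owner ends) (si : s i ≡ free)
                    (p : Owner ends → Fin m → Bool) where

    p-before p-after : Fin m → Bool
    p-before k = p (s k) k
    p-after  k = p (claim ends s i o k) k

    before after : ℕ
    before = count p-before
    after  = count p-after

    balance : after + 𝟙 (p free i) ≡ before + 𝟙 (p o i)
    balance = begin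
      after + 𝟙 (p free i)          ≡⟨ cong (λ o′ → after + 𝟙 (p o′ i)) si ⟨
      after + 𝟙 (p (s i) i)         ≡⟨ cong (_+ 𝟙 (p (s i) i)) (count≡sum p-after) ⟩
      sum (𝟙 ∘ p-after) + 𝟙 (p (s i) i) ≡⟨ sum-claim s i o (λ o′ k → 𝟙 (p o′ k)) ⟩
      sum (𝟙 ∘ p-before) + 𝟙 (p o i) ≡⟨ cong (_+ 𝟙 (p o i)) (count≡sum p-before) ⟨
      before + 𝟙 (p o i)            ∎
      where open ≡-Reasoning

    unchanged : p o i ≡ p free i → after ≡ before
    unchanged same = +-cancelʳ-≡ (𝟙 (p free i)) after before (trans balance (cong (λ b → before + 𝟙 b) same))

    decreases : p o i ≡ false → after ≤ before
    decreases po = begin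
      after                   ≤⟨ m≤m+n after _ ⟩
      after + 𝟙 (p free i)    ≡⟨ balance ⟩
      before + 𝟙 (p o i)      ≡⟨ cong (λ b → before + 𝟙 b) po ⟩
      before + 0              ≡⟨ +-identityʳ before ⟩
      before                  ∎
      where open ≤-Reasoning

    increases : p free i ≡ false → before ≤ after
    increases pf = begin
      before                  ≤⟨ m≤m+n before _ ⟩
      before + 𝟙 (p o i)      ≡⟨ balance ⟨
      after + 𝟙 (p free i)    ≡⟨ cong (λ b → after + 𝟙 b) pf ⟩
      after + 0               ≡⟨ +-identityʳ after ⟩
      after                   ∎
      where open ≤-Reasoning

    at-most-one-more : after ≤ suc before
    at-most-one-more = begin
      after                   ≤⟨ m≤m+n after _ ⟩
      after + 𝟙 (p free i)    ≡⟨ balance ⟩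
      before + 𝟙 (p o i)      ≤⟨ +-monoʳ-≤ before (𝟙≤1 (p o i)) ⟩
      before + 1              ≡⟨ +-comm before 1 ⟩
      suc before              ∎
      where open ≤-Reasoning

    one-more : p o i ≡ true → p free i ≡ false → after ≡ suc before
    one-more po pf = begin
      after                   ≡⟨ +-identityʳ after ⟨
      after + 0               ≡⟨ cong (λ b → after + 𝟙 b) pf ⟨
      after + 𝟙 (p free i)    ≡⟨ balance ⟩
      before + 𝟙 (p o i)      ≡⟨ cong (λ b → before + 𝟙 b) po ⟩
      before + 1              ≡⟨ +-comm before 1 ⟩
      suc before              ∎
      where open ≡-Reasoning

  frees-claim : ∀ {s i o} → s i ≡ free → o ≢ free → suc (frees (claim ends s i o)) ≡ frees s
  frees-claim {s} {i} {o} si o≢free = begin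
    suc after            ≡⟨ +-comm 1 after ⟩
    after + 1            ≡⟨ balance ⟩
    before + 𝟙 (isFree o) ≡⟨ cong (λ b → before + 𝟙 b) (⌊⌋-false (free? o) o≢free) ⟩
    before + 0           ≡⟨ +-identityʳ before ⟩
    before               ∎
    where
    open ≡-Reasoning
    open ClaimCount {s} {i} o si (λ o′ _ → isFree o′)

  breaker-turn : ∀ {ℓ s} → ((∀ j → s j ≢ free) → MakerHasStar ends ℓ s) →
                 (∀ j → s j ≡ free → MakerWins ends ℓ (claim ends s j breaker) makerTurn) →
                 MakerWins ends ℓ s breakerTurn
  breaker-turn {s = s} full⇒star continue with any? (λ j → free? (s j))
  ... | yes some = bmove some continue
  ... | no none  = won (full⇒star (λ j sj → none (j , sj)))

module MakerStrategy {n m : ℕ} (ends : Fin m → Fin n × Fin n)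
                     (simple : Simple ends) (acyclic : ¬ HasCycle ends) (ℓ : ℕ) where
  open Graph ends
  open Game ends

  value : Owner ends → Bool → ℕ
  value free    inF = suc (𝟙 inF)
  value maker   _   = 2
  value breaker _   = 0

  value≤2 : ∀ o inF → value o inF ≤ 2
  value≤2 free    inF = s≤s (𝟙≤1 inF)
  value≤2 maker   _   = ≤-refl
  value≤2 breaker _   = z≤n

  value-mono : ∀ o {b b′} → (b ≡ true → b′ ≡ true) → value o b ≤ value o b′
  value-mono free    b⇒b′ = s≤s (𝟙-mono b⇒b′)
  value-mono maker   _    = ≤-refl
  value-mono breaker _    = z≤n

  contribution : (Fin m → Bool) → Fin n → Owner ends → Fin m → ℕ
  contribution F x o i = if incident (ends i) x then value o (F i) else 0

  potential : (Fin m → Bool) → State ends → Fin n → ℕ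
  potential F s x = sum (λ i → contribution F x (s i) i)

  -- Neither S nor F has to be connected; F's edges lying inside S is what leaves a
  -- vertex of S on each side of a split edge.
  Promising : State ends → Set
  Promising s = Σ[ S ∈ (Fin n → Bool) ] Σ[ F ∈ (Fin m → Bool) ] ((∃[ x ] S x ≡ true)
              × (∀ i → F i ≡ true → S (end₁ i) ≡ true × S (end₂ i) ≡ true)
              × (∀ x → S x ≡ true → 2 * ℓ ∸ 1 ≤ potential F s x))

  potential-full : ∀ {s} F x → (∀ j → s j ≢ free) → potential F s x ≤ 2 * makerDeg s x
  potential-full {s} F x full = begin
    potential F s x              ≤⟨ sum-mono-≤ bound ⟩
    sum (λ i → 2 * 𝟙 (owned i))  ≡⟨ *-distribˡ-sum 2 (𝟙 ∘ owned) ⟨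
    2 * sum (𝟙 ∘ owned)          ≡⟨ cong (2 *_) (count≡sum owned) ⟨
    2 * makerDeg s x             ∎
    where
    open ≤-Reasoning
    owned : Fin m → Bool
    owned i = isMaker ends (s i) ∧ incident (ends i) x
    bound : ∀ i → contribution F x (s i) i ≤ 2 * 𝟙 (owned i)
    bound i with incident (ends i) x | s i in si
    ... | false | free    = z≤n
    ... | false | maker   = z≤n
    ... | false | breaker = z≤n
    ... | true  | free    = ⊥-elim (full i si)
    ... | true  | maker   = ≤-refl
    ... | true  | breaker = z≤n

  promising-full⇒star : ∀ {s} → Promising s → (∀ j → s j ≢ free) → MakerHasStar ends ℓ s
  promising-full⇒star (_ , F , (x , Sx) , _ , charged) full =
    x , 2ℓ∸1≤2k⇒ℓ≤k (≤-trans (charged x Sx) (potential-full F x full))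

  GoodMove : State ends → Set
  GoodMove s = ∃[ i ] (s i ≡ free × Promising (claim ends s i maker)
             × (∀ j → claim ends s i maker j ≡ free → Promising (claim ends (claim ends s i maker) j breaker)))

  module Split {s : State ends} {S : Fin n → Bool} {F : Fin m → Bool}
               (inside : ∀ i → F i ≡ true → S (end₁ i) ≡ true × S (end₂ i) ≡ true)
               (charged : ∀ x → S x ≡ true → 2 * ℓ ∸ 1 ≤ potential F s x)
               (i : Fin m) (Fi : F i ≡ true) where
    open Separation simple acyclic i

    onSide : Bool → Fin n → Bool
    onSide σ v = ⌊ side v ≟ᵇ σ ⌋

    edge-side : ∀ {σ z j} → side z ≡ σ → incident (ends j) z ≡ true → j ≢ i →
                side (end₁ j) ≡ σ × side (end₂ j) ≡ σ
    edge-side {σ} {z} {j} zσ jz j≢i with incident⇒end {j} {z} jz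
    ... | inj₁ refl = zσ , trans (sym (side-edge j j≢i)) zσ
    ... | inj₂ refl = trans (side-edge j j≢i) zσ , zσ

    side-promising : ∀ σ t → t i ≡ maker →
                     (∀ z → side z ≡ σ → ∀ j → incident (ends j) z ≡ true → j ≢ i → t j ≡ s j) →
                     Promising t
    side-promising σ t ti untouched = Sσ , Fσ , nonempty σ , Fσ-inside , charged′
      where
      Sσ : Fin n → Bool
      Sσ v = S v ∧ onSide σ v
      Fσ : Fin m → Bool
      Fσ j = F j ∧ (onSide σ (end₁ j) ∧ onSide σ (end₂ j))

      nonempty : ∀ τ → ∃[ x ] S x ∧ onSide τ x ≡ true
      nonempty true  = end₁ i , cong₂ _∧_ (proj₁ (inside i Fi)) (⌊⌋-true (side (end₁ i) ≟ᵇ true) side-end₁)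
      nonempty false = end₂ i , cong₂ _∧_ (proj₂ (inside i Fi)) (⌊⌋-true (side (end₂ i) ≟ᵇ false) side-end₂)

      Fσ-inside : ∀ j → Fσ j ≡ true → Sσ (end₁ j) ≡ true × Sσ (end₂ j) ≡ true
      Fσ-inside j Fσj = cong₂ _∧_ (proj₁ (inside j Fj)) (∧-conicalˡ _ _ both)
                      , cong₂ _∧_ (proj₂ (inside j Fj)) (∧-conicalʳ _ _ both)
        where
        Fj : F j ≡ true
        Fj = ∧-conicalˡ (F j) _ Fσj
        both : onSide σ (end₁ j) ∧ onSide σ (end₂ j) ≡ true
        both = ∧-conicalʳ (F j) _ Fσj

      charged′ : ∀ z → Sσ z ≡ true → 2 * ℓ ∸ 1 ≤ potential Fσ t z
      charged′ z Sσz = ≤-trans (charged z (∧-conicalˡ _ _ Sσz)) (sum-mono-≤ bound)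
        where
        zσ : side z ≡ σ
        zσ = ⌊⌋-true⁻ (side z ≟ᵇ σ) (∧-conicalʳ _ _ Sσz)
        bound : ∀ j → contribution F z (s j) j ≤ contribution Fσ z (t j) j
        bound j with incident (ends j) z in jz
        ... | false = z≤n
        ... | true with j ≟ i
        ...   | yes refl rewrite ti = value≤2 (s i) (F i)
        ...   | no j≢i rewrite untouched z zσ j jz j≢i =
                  value-mono (s j) (λ Fj → cong₂ _∧_ Fj (cong₂ _∧_ (⌊⌋-true (_ ≟ᵇ σ) (proj₁ ends-σ))
                                                                  (⌊⌋-true (_ ≟ᵇ σ) (proj₂ ends-σ))))
          where ends-σ = edge-side zσ jz j≢i

    split-move : s i ≡ free → GoodMove s
    split-move si = i , si , side-promising true s′ (claim-at s i maker) (λ _ _ _ _ j≢i → claim-other s i maker j≢i)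
                  , respond
      where
      s′ : State ends
      s′ = claim ends s i maker
      respond : ∀ j → s′ j ≡ free → Promising (claim ends s′ j breaker)
      respond j s′j = side-promising σ (claim ends s′ j breaker)
                        (trans (claim-other s′ j breaker i≢j) (claim-at s i maker)) untouched
        where
        -- Breaker's edge j has both ends on the side of end₁ j; Maker continues on the other.
        σ : Bool
        σ = not (side (end₁ j))
        i≢j : i ≢ j
        i≢j refl = case trans (sym (claim-at s i maker)) s′j of λ ()
        untouched : ∀ z → side z ≡ σ → ∀ k → incident (ends k) z ≡ true → k ≢ i →
                    claim ends s′ j breaker k ≡ s k
        untouched z zσ k kz k≢i with k ≟ j
        ... | yes refl = ⊥-elim (not-¬ refl (proj₁ (edge-side zσ kz k≢i)))
        ... | no  _    = claim-other s i maker k≢i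

  ∅ : Fin m → Bool
  ∅ _ = false

  singleton-promising : ∀ x t → 2 * ℓ ∸ 1 ≤ potential ∅ t x → Promising t
  singleton-promising x t charged =
    (λ v → ⌊ v ≟ x ⌋) , ∅ , (x , ⌊⌋-true (x ≟ x) refl) , (λ _ ()) ,
    λ v v≡x → subst (λ v → 2 * ℓ ∸ 1 ≤ potential ∅ t v) (sym (⌊⌋-true⁻ (v ≟ x) v≡x)) charged

  potential-forget : ∀ {s} F x → (∀ i → s i ≡ free → F i ≢ true) → potential F s x ≤ potential ∅ s x
  potential-forget {s} F x unclaimed = sum-mono-≤ bound
    where
    bound : ∀ i → contribution F x (s i) i ≤ contribution ∅ x (s i) i
    bound i with incident (ends i) x | s i in si | F i in Fi
    ... | false | _       | _     = z≤n
    ... | true  | free    | true  = ⊥-elim (unclaimed i si Fi)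
    ... | true  | free    | false = ≤-refl
    ... | true  | maker   | _     = ≤-refl
    ... | true  | breaker | _     = z≤n

  potential∅≤ : ∀ s x → potential ∅ s x ≤ 2 * makerDeg s x + freeDeg s x
  potential∅≤ s x = begin
    potential ∅ s x                                   ≤⟨ sum-mono-≤ bound ⟩
    sum (λ i → 2 * 𝟙 (owned i) + 𝟙 (open′ i))        ≡⟨ ∑-distrib-+ (λ i → 2 * 𝟙 (owned i)) (𝟙 ∘ open′) ⟩
    sum (λ i → 2 * 𝟙 (owned i)) + sum (𝟙 ∘ open′)    ≡⟨ cong₂ _+_ (*-distribˡ-sum 2 (𝟙 ∘ owned)) (count≡sum open′) ⟨
    2 * sum (𝟙 ∘ owned) + freeDeg s x                 ≡⟨ cong (λ c → 2 * c + freeDeg s x) (count≡sum owned) ⟨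
    2 * makerDeg s x + freeDeg s x                    ∎
    where
    open ≤-Reasoning
    owned open′ : Fin m → Bool
    owned i = isMaker ends (s i) ∧ incident (ends i) x
    open′ i = isFree (s i) ∧ incident (ends i) x
    bound : ∀ i → contribution ∅ x (s i) i ≤ 2 * 𝟙 (owned i) + 𝟙 (open′ i)
    bound i with incident (ends i) x | s i
    ... | false | free    = z≤n
    ... | false | maker   = z≤n
    ... | false | breaker = z≤n
    ... | true  | free    = ≤-refl
    ... | true  | maker   = ≤-refl
    ... | true  | breaker = z≤n

  free-incident : ∀ {s x} → 2 * ℓ ∸ 1 ≤ potential ∅ s x → ¬ ℓ ≤ makerDeg s x →
                  ∃[ i ] (s i ≡ free × incident (ends i) x ≡ true)
  free-incident {s} {x} charged no-star with freeDeg s x in fd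
  ... | zero  = ⊥-elim (no-star (2ℓ∸1≤2k⇒ℓ≤k (begin
    2 * ℓ ∸ 1                       ≤⟨ charged ⟩
    potential ∅ s x                 ≤⟨ potential∅≤ s x ⟩
    2 * makerDeg s x + freeDeg s x  ≡⟨ cong (2 * makerDeg s x +_) fd ⟩
    2 * makerDeg s x + 0            ≡⟨ +-identityʳ _ ⟩
    2 * makerDeg s x                ∎)))
    where open ≤-Reasoning
  ... | suc _ with count-positive⇒∃ (λ i → isFree (s i) ∧ incident (ends i) x) (subst (1 ≤_) (sym fd) (s≤s z≤n))
  ...   | i , open′ = i , ⌊⌋-true⁻ (free? (s i)) (∧-conicalˡ _ _ open′) , ∧-conicalʳ (isFree (s i)) _ open′

  contribution-incident : ∀ F x o i → incident (ends i) x ≡ true → contribution F x o i ≡ value o (F i)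
  contribution-incident F x o i ix rewrite ix = refl

  potential-maker-claim : ∀ {s i x} → s i ≡ free → incident (ends i) x ≡ true →
                          suc (potential ∅ s x) ≤ potential ∅ (claim ends s i maker) x
  potential-maker-claim {s} {i} {x} si ix = ≤-reflexive (+-cancelʳ-≡ 1 _ _ (begin
    suc (potential ∅ s x) + 1                  ≡⟨ +-suc (potential ∅ s x) 1 ⟨
    potential ∅ s x + 2                        ≡⟨ cong (potential ∅ s x +_) (contribution-incident ∅ x maker i ix) ⟨
    potential ∅ s x + contribution ∅ x maker i ≡⟨ sum-claim s i maker (contribution ∅ x) ⟨
    potential ∅ s′ x + contribution ∅ x (s i) i ≡⟨ cong (λ o → potential ∅ s′ x + contribution ∅ x o i) si ⟩
    potential ∅ s′ x + contribution ∅ x free i  ≡⟨ cong (potential ∅ s′ x +_) (contribution-incident ∅ x free i ix) ⟩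
    potential ∅ s′ x + 1                        ∎))
    where
    open ≡-Reasoning
    s′ : State ends
    s′ = claim ends s i maker

  potential-breaker-claim : ∀ {s j x} → s j ≡ free → potential ∅ s x ≤ suc (potential ∅ (claim ends s j breaker) x)
  potential-breaker-claim {s} {j} {x} sj = begin
    potential ∅ s x                               ≤⟨ m≤m+n _ _ ⟩
    potential ∅ s x + contribution ∅ x breaker j  ≡⟨ sum-claim s j breaker (contribution ∅ x) ⟨
    potential ∅ s″ x + contribution ∅ x (s j) j   ≡⟨ cong (λ o → potential ∅ s″ x + contribution ∅ x o j) sj ⟩
    potential ∅ s″ x + contribution ∅ x free j    ≤⟨ +-monoʳ-≤ (potential ∅ s″ x) (𝟙≤1 (incident (ends j) x)) ⟩
    potential ∅ s″ x + 1                          ≡⟨ +-comm _ 1 ⟩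
    suc (potential ∅ s″ x)                        ∎
    where
    open ≤-Reasoning
    s″ : State ends
    s″ = claim ends s j breaker

  greedy-move : ∀ {s} x → 2 * ℓ ∸ 1 ≤ potential ∅ s x → MakerHasStar ends ℓ s ⊎ GoodMove s
  greedy-move {s} x charged with ℓ ≤? makerDeg s x
  ... | yes star    = inj₁ (x , star)
  ... | no  no-star with free-incident {s} {x} charged no-star
  ...   | i , si , ix = inj₂ (i , si , singleton-promising x s′ (<⇒≤ raised) , respond)
    where
    s′ : State ends
    s′ = claim ends s i maker
    raised : 2 * ℓ ∸ 1 < potential ∅ s′ x
    raised = ≤-<-trans charged (potential-maker-claim {x = x} si ix)
    respond : ∀ j → s′ j ≡ free → Promising (claim ends s′ j breaker)
    respond j s′j = singleton-promising x _ (≤-pred (≤-trans raised (potential-breaker-claim {x = x} s′j)))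

  best-move : ∀ {s} → Promising s → MakerHasStar ends ℓ s ⊎ GoodMove s
  best-move {s} (S , F , (x , Sx) , inside , charged) with any? (λ i → free? (s i) ×-dec (F i ≟ᵇ true))
  ... | yes (i , si , Fi) = inj₂ (Split.split-move inside charged i Fi si)
  ... | no  none          = greedy-move x (≤-trans (charged x Sx) (potential-forget F x λ i si Fi → none (i , si , Fi)))

  maker-wins : ∀ k s → frees s ≤ k → Promising s → MakerWins ends ℓ s makerTurn
  maker-wins zero s no-frees promising = won (promising-full⇒star promising full)
    where
    full : ∀ j → s j ≢ free
    full j sj = <⇒≱ (count-positive j (⌊⌋-true (free? (s j)) sj)) no-frees
  maker-wins (suc k) s frees≤ promising with best-move promising
  ... | inj₁ star = won star
  ... | inj₂ (i , si , promising′ , respond) =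
        mmove i si (breaker-turn (promising-full⇒star promising′) continue)
    where
    s′ : State ends
    s′ = claim ends s i maker
    continue : ∀ j → s′ j ≡ free → MakerWins ends ℓ (claim ends s′ j breaker) makerTurn
    continue j s′j = maker-wins k _ (<⇒≤ (≤-pred (≤-trans fewer frees≤))) (respond j s′j)
      where
      fewer : suc (suc (frees (claim ends s′ j breaker))) ≤ frees s
      fewer = ≤-reflexive (trans (cong suc (frees-claim s′j λ ())) (frees-claim si λ ()))

  initially-promising : ∀ S F → IsSubtree ends S F →
                        (∀ x → S x ≡ true → 2 * ℓ ∸ 1 ∸ degIn ends F x ≤ deg ends x) →
                        Promising (λ _ → free)
  initially-promising S F (nonempty , inside , _) degrees = S , F , nonempty , inside , charged
    where
    charged : ∀ x → S x ≡ true → 2 * ℓ ∸ 1 ≤ potential F (λ _ → free) x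
    charged x Sx = begin
      2 * ℓ ∸ 1                                   ≤⟨ m≤n+m∸n _ (degIn ends F x) ⟩
      degIn ends F x + (2 * ℓ ∸ 1 ∸ degIn ends F x) ≤⟨ +-monoʳ-≤ _ (degrees x Sx) ⟩
      degIn ends F x + deg ends x                 ≡⟨ +-comm (degIn ends F x) _ ⟩
      deg ends x + degIn ends F x                 ≡⟨ cong₂ _+_ (count≡sum incident′) (count≡sum inF) ⟩
      sum (𝟙 ∘ incident′) + sum (𝟙 ∘ inF)         ≡⟨ ∑-distrib-+ (𝟙 ∘ incident′) (𝟙 ∘ inF) ⟨
      sum (λ i → 𝟙 (incident′ i) + 𝟙 (inF i))     ≤⟨ sum-mono-≤ bound ⟩
      potential F (λ _ → free) x                  ∎
      where
      open ≤-Reasoning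
      incident′ inF : Fin m → Bool
      incident′ i = incident (ends i) x
      inF i = F i ∧ incident (ends i) x
      bound : ∀ i → 𝟙 (incident′ i) + 𝟙 (inF i) ≤ contribution F x free i
      bound i with incident (ends i) x | F i
      ... | false | false = ≤-refl
      ... | false | true  = ≤-refl
      ... | true  | false = ≤-refl
      ... | true  | true  = ≤-refl

module Peeling {n m : ℕ} (ends : Fin m → Fin n × Fin n) (ℓ : ℕ) where
  open Graph ends

  GoodSubtree : Set
  GoodSubtree = ∃[ S ] ∃[ F ] (IsSubtree ends S F ×
                  (∀ x → S x ≡ true → 2 * ℓ ∸ 1 ∸ degIn ends F x ≤ deg ends x))

  inside : (Fin n → Bool) → Fin m → Bool
  inside W i = W (end₁ i) ∧ W (end₂ i)

  outDeg : (Fin n → Bool) → (Fin m → Fin n) → Fin n → ℕ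
  outDeg W h y = count (λ i → inside W i ∧ (incident (ends i) y ∧ not ⌊ h i ≟ y ⌋))

  Orientation : (Fin n → Bool) → Set
  Orientation W = Σ[ h ∈ (Fin m → Fin n) ] (∀ i → incident (ends i) (h i) ≡ true)
                × (∀ y → W y ≡ true → suc (deg ends y + outDeg W h y) ≤ 2 * ℓ ∸ 1)

  Removable : (Fin n → Bool) → Fin n → Set
  Removable W v = W v ≡ true × suc (deg ends v + degIn ends (inside W) v) ≤ 2 * ℓ ∸ 1

  removable? : ∀ W v → Dec (Removable W v)
  removable? W v = (W v ≟ᵇ true) ×-dec (suc (deg ends v + degIn ends (inside W) v) ≤? 2 * ℓ ∸ 1)

  _-_ : (Fin n → Bool) → Fin n → Fin n → Bool
  (W - v) u = W u ∧ not ⌊ u ≟ v ⌋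

  count-remove : ∀ {W v} → W v ≡ true → suc (count (W - v)) ≡ count W
  count-remove {W} {v} Wv = begin
    suc (count (W - v))          ≡⟨ +-comm 1 _ ⟩
    count (W - v) + 1            ≡⟨ cong (λ b → count (W - v) + 𝟙 b) Wv ⟨
    count (W - v) + 𝟙 (W v)      ≡⟨ count-update v agree ⟩
    count W + 𝟙 ((W - v) v)      ≡⟨ cong (λ b → count W + 𝟙 (W v ∧ not b)) (⌊⌋-true (v ≟ v) refl) ⟩
    count W + 𝟙 (W v ∧ false)    ≡⟨ cong (λ b → count W + 𝟙 b) (∧-zeroʳ (W v)) ⟩
    count W + 0                  ≡⟨ +-identityʳ _ ⟩
    count W                      ∎
    where
    open ≡-Reasoning
    agree : ∀ u → u ≢ v → (W - v) u ≡ W u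
    agree u u≢v = trans (cong (λ b → W u ∧ not b) (⌊⌋-false (u ≟ v) u≢v)) (∧-identityʳ (W u))

  other : Fin m → Fin n → Fin n
  other i v = if ⌊ v ≟ end₁ i ⌋ then end₂ i else end₁ i

  other-incident : ∀ i v → incident (ends i) (other i v) ≡ true
  other-incident i v with ⌊ v ≟ end₁ i ⌋
  ... | true  = incident-end₂ i
  ... | false = incident-end₁ i

  other-of-incident : ∀ {i v y} → incident (ends i) v ≡ true → incident (ends i) y ≡ true → y ≢ v → other i v ≡ y
  other-of-incident {i} {v} {y} iv iy y≢v with v ≟ end₁ i | incident⇒end {i} {y} iy
  ... | yes refl | inj₁ refl = ⊥-elim (y≢v refl)
  ... | yes refl | inj₂ refl = refl
  ... | no  v≢₁  | inj₁ refl = refl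
  ... | no  _    | inj₂ refl = ⊥-elim (y≢v (sym (⌊⌋-true⁻ (v ≟ end₂ i) iv)))

  not-incident : ∀ {i v} → incident (ends i) v ≡ false → end₁ i ≢ v × end₂ i ≢ v
  not-incident {i} iv = (λ { refl → case trans (sym (incident-end₁ i)) iv of λ () })
                      , (λ { refl → case trans (sym (incident-end₂ i)) iv of λ () })

  inside-remove : ∀ {W v i} → incident (ends i) v ≡ false → inside W i ≡ true → inside (W - v) i ≡ true
  inside-remove {W} {v} {i} iv e
    rewrite ⌊⌋-false (end₁ i ≟ v) (proj₁ (not-incident iv)) | ⌊⌋-false (end₂ i ≟ v) (proj₂ (not-incident iv))
          | ∧-identityʳ (W (end₁ i)) | ∧-identityʳ (W (end₂ i)) = e

  extend-orientation : ∀ {W v} → Removable W v → Orientation (W - v) → Orientation W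
  extend-orientation {W} {v} (_ , v-low) (h′ , h′-incident , h′-bound) = h , h-incident , h-bound
    where
    -- The edges at the deleted vertex v point to their other ends, which are deleted later.
    h : Fin m → Fin n
    h i = if incident (ends i) v then other i v else h′ i

    h-incident : ∀ i → incident (ends i) (h i) ≡ true
    h-incident i with incident (ends i) v
    ... | true  = other-incident i v
    ... | false = h′-incident i

    out⊆inside : ∀ i → inside W i ∧ (incident (ends i) v ∧ not ⌊ h i ≟ v ⌋) ≡ true →
                 inside W i ∧ incident (ends i) v ≡ true
    out⊆inside i e with inside W i | incident (ends i) v
    out⊆inside i e  | true  | true  = refl
    out⊆inside i () | false | _
    out⊆inside i () | true  | false

    out⊆out′ : ∀ {y} → y ≢ v → ∀ i → inside W i ∧ (incident (ends i) y ∧ not ⌊ h i ≟ y ⌋) ≡ true →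
               inside (W - v) i ∧ (incident (ends i) y ∧ not ⌊ h′ i ≟ y ⌋) ≡ true
    out⊆out′ {y} y≢v i e with incident (ends i) v in iv
    ... | true  = ⊥-elim (⌊⌋-false⁻ (other i v ≟ y) (not-injective away) (other-of-incident iv iy y≢v))
      where
      iy∧away = ∧-conicalʳ (inside W i) _ e
      iy = ∧-conicalˡ (incident (ends i) y) _ iy∧away
      away = ∧-conicalʳ (incident (ends i) y) _ iy∧away
    ... | false = cong₂ _∧_ (inside-remove {W} iv (∧-conicalˡ (inside W i) _ e)) (∧-conicalʳ (inside W i) _ e)

    h-bound : ∀ y → W y ≡ true → suc (deg ends y + outDeg W h y) ≤ 2 * ℓ ∸ 1
    h-bound y Wy with y ≟ v
    ... | yes refl = ≤-trans (s≤s (+-monoʳ-≤ (deg ends y) (count-mono-≤ out⊆inside))) v-low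
    ... | no  y≢v  = ≤-trans (s≤s (+-monoʳ-≤ (deg ends y) (count-mono-≤ (out⊆out′ y≢v))))
                             (h′-bound y (cong₂ _∧_ Wy (cong not (⌊⌋-false (y ≟ v) y≢v))))

  stuck⇒subtree : ∀ {W} → (∃[ w ] W w ≡ true) → (∀ v → ¬ Removable W v) → GoodSubtree
  stuck⇒subtree {W} (w , Ww) stuck = reach , F , ((w , reach-source) , F-inside , connected) , degrees
    where
    open Reach (inside W) w

    F : Fin m → Bool
    F i = inside W i ∧ (reach (end₁ i) ∧ reach (end₂ i))

    F-inside : ∀ i → F i ≡ true → reach (end₁ i) ≡ true × reach (end₂ i) ≡ true
    F-inside i Fi = ∧-conicalˡ _ _ both , ∧-conicalʳ _ _ both
      where both = ∧-conicalʳ (inside W i) _ Fi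

    into-F : ∀ {i a b} → inside W i ≡ true → Joins ends i a b → reach a ≡ true → F i ≡ true × reach b ≡ true
    into-F {i} Wi ab ra with reach-edge Wi ab ra | Joins⇒ends ab
    ... | r₁ , r₂ | inj₁ (_ , refl) = cong₂ _∧_ Wi (cong₂ _∧_ r₁ r₂) , r₂
    ... | r₁ , r₂ | inj₂ (_ , refl) = cong₂ _∧_ Wi (cong₂ _∧_ r₁ r₂) , r₁

    connected : ∀ u v → reach u ≡ true → reach v ≡ true → Walk ends F u v
    connected u v ru rv = reverseʷ (from-root u ru) ++ʷ from-root v rv
      where
      from-root : ∀ z → reach z ≡ true → Walk ends F w z
      from-root z rz = walk-restrict reach into-F reach-source (reach-walk z rz)

    in-W : ∀ {x} → reach x ≡ true → W x ≡ true
    in-W {x} rx = walk-preserves W stays Ww (reach-walk x rx)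
      where
      stays : ∀ {i a b} → inside W i ≡ true → Joins ends i a b → W a ≡ true → W b ≡ true
      stays {i} Wi ab _ with Joins⇒ends ab
      ... | inj₁ (_ , refl) = ∧-conicalʳ _ _ Wi
      ... | inj₂ (_ , refl) = ∧-conicalˡ _ _ Wi

    degrees : ∀ x → reach x ≡ true → 2 * ℓ ∸ 1 ∸ degIn ends F x ≤ deg ends x
    degrees x rx = m≤n+o⇒m∸n≤o (2 * ℓ ∸ 1) (degIn ends F x) (begin
      2 * ℓ ∸ 1                              ≤⟨ ≤-pred (≰⇒> λ low → stuck x (in-W rx , low)) ⟩
      deg ends x + degIn ends (inside W) x   ≤⟨ +-monoʳ-≤ (deg ends x) (count-mono-≤ inside⊆F) ⟩
      deg ends x + degIn ends F x            ≡⟨ +-comm (deg ends x) _ ⟩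
      degIn ends F x + deg ends x            ∎)
      where
      open ≤-Reasoning
      inside⊆F : ∀ i → inside W i ∧ incident (ends i) x ≡ true → F i ∧ incident (ends i) x ≡ true
      inside⊆F i e = cong₂ _∧_ (cong₂ _∧_ Wi (cong₂ _∧_ (proj₁ ends-reached) (proj₂ ends-reached))) ix
        where
        Wi : inside W i ≡ true
        Wi = ∧-conicalˡ (inside W i) _ e
        ix : incident (ends i) x ≡ true
        ix = ∧-conicalʳ (inside W i) _ e
        ends-reached : reach (end₁ i) ≡ true × reach (end₂ i) ≡ true
        ends-reached with incident⇒end {i} {x} ix
        ... | inj₁ x≡ = reach-edge Wi (inj₁ refl) (subst (λ z → reach z ≡ true) x≡ rx)
        ... | inj₂ x≡ = reach-edge Wi (inj₂ refl) (subst (λ z → reach z ≡ true) x≡ rx)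

  peel : ∀ k W → count W ≡ k → GoodSubtree ⊎ Orientation W
  peel zero W empty = inj₂ (end₁ , incident-end₁ , λ y Wy → ⊥-elim (<⇒≱ (count-positive y Wy) (≤-reflexive empty)))
  peel (suc k) W size with any? (removable? W)
  ... | yes (v , removable) = map₂ (extend-orientation removable)
                                (peel k (W - v) (suc-injective (trans (count-remove (proj₁ removable)) size)))
  ... | no  stuck           = inj₁ (stuck⇒subtree (count-positive⇒∃ W (subst (1 ≤_) (sym size) (s≤s z≤n)))
                                                  (λ v removable → stuck (v , removable)))

module BreakerStrategy {n m : ℕ} (ends : Fin m → Fin n × Fin n) (ℓ : ℕ) (1≤ℓ : 1 ≤ ℓ)
                       (orientation : Peeling.Orientation ends ℓ (λ _ → true)) where
  open Game ends
  open Peeling ends ℓ using (outDeg)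

  h : Fin m → Fin n
  h = proj₁ orientation

  h-incident : ∀ i → incident (ends i) (h i) ≡ true
  h-incident = proj₁ (proj₂ orientation)

  low-degree : ∀ y → suc (deg ends y + outDeg (λ _ → true) h y) ≤ 2 * ℓ ∸ 1
  low-degree y = proj₂ (proj₂ orientation) y refl

  into breakerAt freeAt : Fin n → Owner ends → Fin m → Bool
  into      y o i = isMaker ends o ∧ ⌊ h i ≟ y ⌋
  breakerAt y o i = isBreaker o ∧ incident (ends i) y
  freeAt    y o i = isFree o ∧ incident (ends i) y

  towards : State ends → Fin n → ℕ
  towards s y = count (λ i → into y (s i) i)

  -- Only a Maker edge into y claimed when y has no free edge left goes unanswered.
  Balanced : State ends → Fin n → Set
  Balanced s y = towards s y ≤ breakerDeg s y ⊎ (towards s y ≤ suc (breakerDeg s y) × freeDeg s y ≡ 0)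

  balanced-weaken : ∀ {s y} → Balanced s y → towards s y ≤ suc (breakerDeg s y)
  balanced-weaken (inj₁ ≤bd)      = m≤n⇒m≤1+n ≤bd
  balanced-weaken (inj₂ (≤1+bd , _)) = ≤1+bd

  balanced-mono : ∀ {s t y} → towards t y ≤ towards s y → breakerDeg s y ≤ breakerDeg t y →
                  freeDeg t y ≤ freeDeg s y → Balanced s y → Balanced t y
  balanced-mono         tw bd fd (inj₁ ≤bd)               = inj₁ (≤-trans tw (≤-trans ≤bd bd))
  balanced-mono {t = t} {y} tw bd fd (inj₂ (≤1+bd , no-free)) =
    inj₂ (≤-trans tw (≤-trans ≤1+bd (s≤s bd)) , n≤0⇒n≡0 (subst (freeDeg t y ≤_) no-free fd))

  no-star : ∀ {s y} → towards s y ≤ suc (breakerDeg s y) → ¬ ℓ ≤ makerDeg s y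
  no-star {s} {y} ≤1+bd = <⇒≱ (2k≤2ℓ∸1⇒k<ℓ 1≤ℓ (begin
    2 * mk                           ≡⟨ cong (mk +_) (+-identityʳ mk) ⟩
    mk + mk                          ≤⟨ +-monoʳ-≤ mk (count-≤-+ split) ⟩
    mk + (towards s y + away)        ≤⟨ +-monoʳ-≤ mk (+-monoˡ-≤ away ≤1+bd) ⟩
    mk + (suc (breakerDeg s y) + away) ≡⟨ rearrange mk (breakerDeg s y) away ⟩
    suc (mk + breakerDeg s y + away) ≤⟨ s≤s (+-monoˡ-≤ away (count-+-≤ disjoint)) ⟩
    suc (deg ends y + away)          ≤⟨ low-degree y ⟩
    2 * ℓ ∸ 1                        ∎))
    where
    open ≤-Reasoning
    open +-*-Solver
    mk away : ℕ
    mk   = makerDeg s y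
    away = outDeg (λ _ → true) h y
    rearrange : ∀ a b c → a + (suc b + c) ≡ suc (a + b + c)
    rearrange = solve 3 (λ a b c → a :+ ((con 1 :+ b) :+ c) := con 1 :+ ((a :+ b) :+ c)) refl
    split : ∀ i → 𝟙 (isMaker ends (s i) ∧ incident (ends i) y)
                ≤ 𝟙 (into y (s i) i) + 𝟙 (incident (ends i) y ∧ not ⌊ h i ≟ y ⌋)
    split i with isMaker ends (s i) | incident (ends i) y | ⌊ h i ≟ y ⌋
    ... | false | _     | _     = z≤n
    ... | true  | false | _     = z≤n
    ... | true  | true  | true  = ≤-refl
    ... | true  | true  | false = ≤-refl
    disjoint : ∀ i → 𝟙 (isMaker ends (s i) ∧ incident (ends i) y) + 𝟙 (breakerAt y (s i) i)
                   ≤ 𝟙 (incident (ends i) y)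
    disjoint i with s i | incident (ends i) y
    ... | free    | b     = 𝟙-mono (λ ())
    ... | maker   | false = z≤n
    ... | maker   | true  = ≤-refl
    ... | breaker | false = z≤n
    ... | breaker | true  = ≤-refl

  module _ {s : State ends} where

    maker-claim-balanced : ∀ {i} → s i ≡ free → ∀ z → z ≢ h i → Balanced s z → Balanced (claim ends s i maker) z
    maker-claim-balanced {i} si z z≢hi = balanced-mono
      (≤-reflexive (ClaimCount.unchanged maker si (into z) (⌊⌋-false (h i ≟ z) (z≢hi ∘ sym))))
      (≤-reflexive (sym (ClaimCount.unchanged maker si (breakerAt z) refl)))
      (ClaimCount.decreases maker si (freeAt z) refl)

    maker-claim-towards : ∀ {i} → s i ≡ free → Balanced s (h i) →
                          towards (claim ends s i maker) (h i) ≤ suc (breakerDeg (claim ends s i maker) (h i))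
    maker-claim-towards {i} si (inj₁ ≤bd) = begin
      towards (claim ends s i maker) (h i)        ≤⟨ ClaimCount.at-most-one-more maker si (into (h i)) ⟩
      suc (towards s (h i))                       ≤⟨ s≤s ≤bd ⟩
      suc (breakerDeg s (h i))                    ≡⟨ cong suc (ClaimCount.unchanged maker si (breakerAt (h i)) refl) ⟨
      suc (breakerDeg (claim ends s i maker) (h i)) ∎
      where open ≤-Reasoning
    maker-claim-towards {i} si (inj₂ (_ , no-free)) =
      ⊥-elim (<⇒≱ (count-positive i (cong₂ _∧_ (⌊⌋-true (free? (s i)) si) (h-incident i))) (≤-reflexive no-free))

    breaker-claim-balanced : ∀ {j} → s j ≡ free → ∀ z → Balanced s z → Balanced (claim ends s j breaker) z
    breaker-claim-balanced {j} sj z = balanced-mono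
      (≤-reflexive (ClaimCount.unchanged breaker sj (into z) refl))
      (ClaimCount.increases breaker sj (breakerAt z) refl)
      (ClaimCount.decreases breaker sj (freeAt z) refl)

    breaker-claim-blocks : ∀ {j y} → s j ≡ free → incident (ends j) y ≡ true →
                           towards s y ≤ suc (breakerDeg s y) → Balanced (claim ends s j breaker) y
    breaker-claim-blocks {j} {y} sj jy ≤1+bd = inj₁ (begin
      towards (claim ends s j breaker) y   ≡⟨ ClaimCount.unchanged breaker sj (into y) refl ⟩
      towards s y                          ≤⟨ ≤1+bd ⟩
      suc (breakerDeg s y)                 ≡⟨ ClaimCount.one-more breaker sj (breakerAt y) jy refl ⟨
      breakerDeg (claim ends s j breaker) y ∎)
      where open ≤-Reasoning

    breaker-claim-elsewhere : ∀ {j y} → s j ≡ free → freeDeg s y ≡ 0 →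
                              towards s y ≤ suc (breakerDeg s y) → Balanced (claim ends s j breaker) y
    breaker-claim-elsewhere {j} {y} sj no-free ≤1+bd =
      inj₂ ( ≤-trans (≤-reflexive (ClaimCount.unchanged breaker sj (into y) refl))
                     (≤-trans ≤1+bd (s≤s (ClaimCount.increases breaker sj (breakerAt y) refl)))
           , n≤0⇒n≡0 (subst (freeDeg (claim ends s j breaker) y ≤_) no-free
                        (ClaimCount.decreases breaker sj (freeAt y) refl)))

  mutual
    maker-loses : ∀ s → (∀ z → Balanced s z) → ¬ MakerWins ends ℓ s makerTurn
    maker-loses s balanced (won (z , star)) = no-star (balanced-weaken (balanced z)) star
    maker-loses s balanced (mmove i si wins) =
      maker-loses-after (claim ends s i maker) (h i)
        (λ z z≢hi → maker-claim-balanced si z z≢hi (balanced z)) (maker-claim-towards si (balanced (h i))) wins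

    maker-loses-after : ∀ s y → (∀ z → z ≢ y → Balanced s z) → towards s y ≤ suc (breakerDeg s y) →
                        ¬ MakerWins ends ℓ s breakerTurn
    maker-loses-after s y balanced ≤1+bd (won (z , star)) with z ≟ y
    ... | yes refl = no-star ≤1+bd star
    ... | no  z≢y  = no-star (balanced-weaken (balanced z z≢y)) star
    maker-loses-after s y balanced ≤1+bd (bmove (j₀ , sj₀) wins) =
      reply (any? (λ j → isFree (s j) ∧ incident (ends j) y ≟ᵇ true))
      where
      respond : ∀ j → s j ≡ free → Balanced (claim ends s j breaker) y → ⊥
      respond j sj at-y = maker-loses (claim ends s j breaker) rebalanced (wins j sj)
        where
        rebalanced : ∀ z → Balanced (claim ends s j breaker) z
        rebalanced z with z ≟ y
        ... | yes refl = at-y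
        ... | no  z≢y  = breaker-claim-balanced sj z (balanced z z≢y)

      reply : Dec (∃[ j ] isFree (s j) ∧ incident (ends j) y ≡ true) → ⊥
      reply (yes (j , open′)) = respond j sj (breaker-claim-blocks sj (∧-conicalʳ (isFree (s j)) _ open′) ≤1+bd)
        where sj = ⌊⌋-true⁻ (free? (s j)) (∧-conicalˡ _ _ open′)
      reply (no none) = respond j₀ sj₀ (breaker-claim-elsewhere sj₀ no-free ≤1+bd)
        where
        no-free : freeDeg s y ≡ 0
        no-free = count-none _ (λ j → ¬-not (λ open′ → none (j , open′)))

  breaker-wins : ¬ MakerWinsGame ends ℓ
  breaker-wins = maker-loses (λ _ → free) λ z →
    inj₁ (subst (_≤ breakerDeg (λ _ → free) z) (sym (nothing-towards z)) z≤n)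
    where
    nothing-towards : ∀ z → towards (λ _ → free) z ≡ 0
    nothing-towards z = count-none (λ i → into z free i) (λ _ → refl)

theorem16 : (n m : ℕ) (ends : Fin m → Fin n × Fin n) → IsTree ends →
    (ℓ : ℕ) → 1 ≤ ℓ →
    MakerWinsGame ends ℓ ⇔
      (∃[ S ] ∃[ F ] (IsSubtree ends S F ×
        (∀ x → S x ≡ true → 2 * ℓ ∸ 1 ∸ degIn ends F x ≤ deg ends x)))
theorem16 n m ends (_ , simple , _ , acyclic) ℓ 1≤ℓ = mk⇔ subtree-from-win win-from-subtree
  where
  open Peeling ends ℓ using (GoodSubtree; peel)
  open MakerStrategy ends simple acyclic ℓ using (maker-wins; initially-promising)

  subtree-from-win : MakerWinsGame ends ℓ → GoodSubtree
  subtree-from-win wins with peel _ (λ _ → true) refl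
  ... | inj₁ subtree     = subtree
  ... | inj₂ orientation = ⊥-elim (BreakerStrategy.breaker-wins ends ℓ 1≤ℓ orientation wins)

  win-from-subtree : GoodSubtree → MakerWinsGame ends ℓ
  win-from-subtree (S , F , subtree , degrees) =
    maker-wins _ (λ _ → free) ≤-refl (initially-promising S F subtree degrees)
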